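{- Let $A$ be a finite-dimensional algebra over a field $k$ and let $I$ be a two-sided ideal of $A$. Then $\mathrm{SR}(A/I) \le \mathrm{SR}(A)$.
   Context: For a finite-dimensional $k$-algebra $A$, its multiplication tensor $T_A$ is the trilinear form $A \times A \times A^* \to k$, $(a,b,\varphi)\mapsto \varphi(ab)$ (in a basis $e_1,\dots,e_n$ with dual basis $e_i^*$, $T_A=\sum_{i,j} e_i^*\otimes e_j^*\otimes (e_ie_j)$), and $\mathrm{SR}(A)$ denotes the slice rank of $T_A$. The slice rank of a trilinear form $T: U_1\times U_2\times U_3\to k$ on finite-dimensional spaces is the minimum of $\operatorname{codim}V_1+\operatorname{codim}V_2+\operatorname{codim}V_3$ over subspaces $V_i\le U_i$ with $T(V_1,V_2,V_3)=0$ (equivalently, the least $r$ such that $T$ is a sum of $r$ trilinear forms each a product of a linear form in one argument and a bilinear form in the other two). -}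

module Defs where

open import Level using (Level; _⊔_; suc)
open import Data.Nat using (ℕ; zero) renaming (suc to sucℕ; _+_ to _+ℕ_)
open import Data.Fin using (Fin) renaming (zero to fzero; suc to fsuc)
open import Data.Product using (Σ; ∃; _×_; _,_)
open import Relation.Nullary using (¬_)
open import Relation.Binary.PropositionalEquality using (_≡_)
open import Algebra.Bundles using (CommutativeRing)

record Field (c ℓ : Level) : Set (suc (c ⊔ ℓ)) where
  field
    commutativeRing : CommutativeRing c ℓ
  open CommutativeRing commutativeRing public
  field
    0≉1     : ¬ (0# ≈ 1#)
    inverse : ∀ x → ¬ (x ≈ 0#) → ∃ λ y → x * y ≈ 1#

module _ {c ℓ : Level} (F : Field c ℓ) where
  open Field F

  Vec : ℕ → Set c
  Vec n = Fin n → Carrier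

  ∑ : ∀ {n} → (Fin n → Carrier) → Carrier
  ∑ {zero}   f = 0#
  ∑ {sucℕ n} f = f fzero + ∑ (λ i → f (fsuc i))

  _≋_ : ∀ {n} → Vec n → Vec n → Set ℓ
  x ≋ y = ∀ i → x i ≈ y i

  -- A finite-dimensional (associative, unital) k-algebra with basis
  -- e_0..e_{n-1}, given by structure constants: e_i e_j = ∑_k mult i j k e_k.
  record FDAlgebra (n : ℕ) : Set (c ⊔ ℓ) where
    field
      mult : Fin n → Fin n → Fin n → Carrier
    _·_ : Vec n → Vec n → Vec n
    (x · y) k = ∑ (λ i → ∑ (λ j → (x i * y j) * mult i j k))
    field
      assoc : ∀ x y z → ((x · y) · z) ≋ (x · (y · z))
      unit  : ∃ λ u → ∀ x → ((u · x) ≋ x) × ((x · u) ≋ x)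

  record Ideal {n : ℕ} (A : FDAlgebra n) (p : Level) : Set (c ⊔ ℓ ⊔ suc p) where
    open FDAlgebra A
    field
      _∈I     : Vec n → Set p
      resp    : ∀ {x y} → x ≋ y → x ∈I → y ∈I
      zero∈   : (λ _ → 0#) ∈I
      +-closed : ∀ {x y} → x ∈I → y ∈I → (λ i → x i + y i) ∈I
      ·-closed : ∀ a {x} → x ∈I → (λ i → a * x i) ∈I
      left     : ∀ a {x} → x ∈I → (a · x) ∈I
      right    : ∀ a {x} → x ∈I → (x · a) ∈I

  -- Trilinear forms U₁ × U₂ × U₃ → k with dim Uᵢ = nᵢ, in coordinates:
  -- T i j k = T(e_i, e_j, e_k).
  Trilinear : ℕ → ℕ → ℕ → Set c
  Trilinear n₁ n₂ n₃ = Fin n₁ → Fin n₂ → Fin n₃ → Carrier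

  -- Multiplication tensor T_A(a, b, φ) = φ(ab) of A, in the bases
  -- e_i, e_j of A and the dual basis e_k^* of A^*:
  -- T_A(e_i, e_j, e_k^*) = e_k^*(e_i e_j) = mult i j k.
  mulTensor : ∀ {n} → FDAlgebra n → Trilinear n n n
  mulTensor A = FDAlgebra.mult A

  -- SliceRank≤ T r : T is a sum of r trilinear forms, each the product of a
  -- linear form in one argument and a bilinear form in the other two
  -- (r₁ slices of the first kind, r₂ of the second, r₃ of the third).
  -- Since slice rank is the least such r, "SR(T) ≤ r" is exactly this.
  SliceRank≤ : ∀ {n₁ n₂ n₃} → Trilinear n₁ n₂ n₃ → ℕ → Set (c ⊔ ℓ)
  SliceRank≤ {n₁} {n₂} {n₃} T r =
    Σ ℕ λ r₁ → Σ ℕ λ r₂ → Σ ℕ λ r₃ → (r₁ +ℕ r₂ +ℕ r₃ ≡ r) ×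
    Σ (Fin r₁ → Fin n₁ → Carrier) λ α₁ → Σ (Fin r₁ → Fin n₂ → Fin n₃ → Carrier) λ β₁ →
    Σ (Fin r₂ → Fin n₂ → Carrier) λ α₂ → Σ (Fin r₂ → Fin n₁ → Fin n₃ → Carrier) λ β₂ →
    Σ (Fin r₃ → Fin n₃ → Carrier) λ α₃ → Σ (Fin r₃ → Fin n₁ → Fin n₂ → Carrier) λ β₃ →
      ∀ i j k → T i j k ≈
        (∑ (λ s → α₁ s i * β₁ s j k) + ∑ (λ s → α₂ s j * β₂ s i k))
          + ∑ (λ s → α₃ s k * β₃ s i j)

  -- "SR(T) ≤ SR(T')", stated without computing the minimum:
  -- every bound on SR(T') is a bound on SR(T).
  _SR≤_ : ∀ {n₁ n₂ n₃ m₁ m₂ m₃} → Trilinear n₁ n₂ n₃ → Trilinear m₁ m₂ m₃ → Set (c ⊔ ℓ)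
  T SR≤ T' = ∀ r → SliceRank≤ T' r → SliceRank≤ T r

  apply : ∀ {m n} → (Fin m → Fin n → Carrier) → Vec n → Vec m
  apply P x i = ∑ (λ j → P i j * x j)

  -- B (with the linear map π : A → B) is a quotient algebra A/I:
  -- π is a surjective algebra homomorphism with kernel exactly I.
  -- (By the first isomorphism theorem this characterises A/I up to
  -- isomorphism, with π the canonical projection.)
  record IsQuotientBy {n m : ℕ} {p : Level} (A : FDAlgebra n) (I : Ideal A p)
                      (B : FDAlgebra m) (π : Fin m → Fin n → Carrier)
                      : Set (c ⊔ ℓ ⊔ p) where
    module A = FDAlgebra A
    module B = FDAlgebra B
    open Ideal I
    field
      surjective     : ∀ y → ∃ λ x → apply π x ≋ y
      multiplicative : ∀ x y → apply π (x A.· y) ≋ (apply π x B.· apply π y)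
      kernel→I       : ∀ x → apply π x ≋ (λ _ → 0#) → x ∈I
      I→kernel       : ∀ x → x ∈I → apply π x ≋ (λ _ → 0#)

{-# OPTIONS --safe #-}
-- Choose lifts X i ∈ A of the basis vectors of B = A/I. Then
-- mult_B(i,j,k) = e_k^*(π(X_i X_j)) = ∑ X_{ia} X_{jb} π_{kc} mult_A(a,b,c),
-- so T_B is the restriction of T_A along the linear maps X, X and πᵀ.
-- Restricting a slice along linear maps gives a slice of the same kind,
-- so any slice decomposition of T_A restricts to one of T_B of the same length.
module Submission where

open import Defs
open import Level using (Level)
open import Data.Nat using (ℕ; zero) renaming (suc to sucℕ)
open import Data.Fin using (Fin) renaming (zero to fzero; suc to fsuc)
open import Data.Product using (∃; _,_; proj₁; proj₂)
open import Relation.Binary.PropositionalEquality as ≡ using (_≡_)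
import Algebra.Properties.Semiring.Sum as SemiringSum
import Algebra.Solver.CommutativeMonoid as CommutativeMonoidSolver

module _ {c ℓ : Level} (F : Field c ℓ) where
  open Field F
  open import Relation.Binary.Reasoning.Setoid setoid
  private
    module S = SemiringSum semiring
    open CommutativeMonoidSolver *-commutativeMonoid using (solve; _⊕_; _⊜_)

  ∑≡sum : ∀ {n} (f : Fin n → Carrier) → ∑ F f ≡ S.sum {n} f
  ∑≡sum {zero}   f = ≡.refl
  ∑≡sum {sucℕ n} f = ≡.cong (f fzero +_) (∑≡sum (λ i → f (fsuc i)))

  ∑≈sum : ∀ {n} (f : Fin n → Carrier) → ∑ F f ≈ S.sum {n} f
  ∑≈sum f = reflexive (∑≡sum f)

  ∑-cong : ∀ {n} {f g : Fin n → Carrier} → (∀ i → f i ≈ g i) → ∑ F f ≈ ∑ F g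
  ∑-cong {f = f} {g} f≈g = begin
    ∑ F f   ≈⟨ ∑≈sum f ⟩
    S.sum f ≈⟨ S.sum-cong-≋ f≈g ⟩
    S.sum g ≈⟨ ∑≈sum g ⟨
    ∑ F g   ∎

  ∑-zero : ∀ n → ∑ F {n} (λ _ → 0#) ≈ 0#
  ∑-zero n = trans (∑≈sum {n} (λ _ → 0#)) (S.sum-replicate-zero n)

  ∑-distrib-+ : ∀ {n} (f g : Fin n → Carrier) → ∑ F (λ i → f i + g i) ≈ ∑ F f + ∑ F g
  ∑-distrib-+ f g = begin
    ∑ F (λ i → f i + g i)   ≈⟨ ∑≈sum (λ i → f i + g i) ⟩
    S.sum (λ i → f i + g i) ≈⟨ S.∑-distrib-+ f g ⟩
    S.sum f + S.sum g       ≈⟨ +-cong (∑≈sum f) (∑≈sum g) ⟨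
    ∑ F f + ∑ F g           ∎

  ∑-comm : ∀ {m n} (f : Fin m → Fin n → Carrier) →
           ∑ F (λ i → ∑ F (f i)) ≈ ∑ F (λ j → ∑ F (λ i → f i j))
  ∑-comm f = begin
    ∑ F (λ i → ∑ F (f i))                 ≈⟨ ∑-cong (λ i → ∑≈sum (f i)) ⟩
    ∑ F (λ i → S.sum (f i))               ≈⟨ ∑≈sum (λ i → S.sum (f i)) ⟩
    S.sum (λ i → S.sum (f i))             ≈⟨ S.∑-comm f ⟩
    S.sum (λ j → S.sum (λ i → f i j))     ≈⟨ ∑≈sum (λ j → S.sum (λ i → f i j)) ⟨
    ∑ F (λ j → S.sum (λ i → f i j))       ≈⟨ ∑-cong (λ j → ∑≈sum (λ i → f i j)) ⟨
    ∑ F (λ j → ∑ F (λ i → f i j))         ∎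

  *-distribˡ-∑ : ∀ {n} x (f : Fin n → Carrier) → x * ∑ F f ≈ ∑ F (λ i → x * f i)
  *-distribˡ-∑ x f = begin
    x * ∑ F f               ≈⟨ *-congˡ (∑≈sum f) ⟩
    x * S.sum f             ≈⟨ S.*-distribˡ-sum x f ⟩
    S.sum (λ i → x * f i)   ≈⟨ ∑≈sum (λ i → x * f i) ⟨
    ∑ F (λ i → x * f i)     ∎

  *-distribʳ-∑ : ∀ {n} x (f : Fin n → Carrier) → ∑ F f * x ≈ ∑ F (λ i → f i * x)
  *-distribʳ-∑ x f = begin
    ∑ F f * x               ≈⟨ *-congʳ (∑≈sum f) ⟩
    S.sum f * x             ≈⟨ S.*-distribʳ-sum x f ⟩
    S.sum (λ i → f i * x)   ≈⟨ ∑≈sum (λ i → f i * x) ⟨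
    ∑ F (λ i → f i * x)     ∎

  basis : ∀ {n} → Fin n → Vec F n
  basis fzero    fzero    = 1#
  basis fzero    (fsuc _) = 0#
  basis (fsuc _) fzero    = 0#
  basis (fsuc i) (fsuc j) = basis i j

  ∑-basis : ∀ {n} (i : Fin n) (f : Fin n → Carrier) → ∑ F (λ a → basis i a * f a) ≈ f i
  ∑-basis {sucℕ n} fzero f = begin
    1# * f fzero + ∑ F (λ a → 0# * f (fsuc a))
      ≈⟨ +-cong (*-identityˡ _) (trans (∑-cong (λ a → zeroˡ (f (fsuc a)))) (∑-zero n)) ⟩
    f fzero + 0#  ≈⟨ +-identityʳ _ ⟩
    f fzero       ∎
  ∑-basis {sucℕ n} (fsuc i) f = begin
    0# * f fzero + ∑ F (λ a → basis i a * f (fsuc a))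
      ≈⟨ +-cong (zeroˡ _) (∑-basis i (λ a → f (fsuc a))) ⟩
    0# + f (fsuc i) ≈⟨ +-identityˡ _ ⟩
    f (fsuc i)      ∎

  module Sum³ {n₁ n₂ n₃ : ℕ} where

    ∑³ : (Fin n₁ → Fin n₂ → Fin n₃ → Carrier) → Carrier
    ∑³ f = ∑ F (λ a → ∑ F (λ b → ∑ F (λ c → f a b c)))

    ∑³-cong : ∀ {f g} → (∀ a b c → f a b c ≈ g a b c) → ∑³ f ≈ ∑³ g
    ∑³-cong f≈g = ∑-cong (λ a → ∑-cong (λ b → ∑-cong (λ c → f≈g a b c)))

    ∑³-distrib-+ : ∀ f g → ∑³ (λ a b c → f a b c + g a b c) ≈ ∑³ f + ∑³ g
    ∑³-distrib-+ f g =
      trans (∑-cong (λ a → trans (∑-cong (λ b → ∑-distrib-+ (f a b) (g a b)))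
                                 (∑-distrib-+ (λ b → ∑ F (f a b)) (λ b → ∑ F (g a b)))))
            (∑-distrib-+ (λ a → ∑ F (λ b → ∑ F (f a b))) (λ a → ∑ F (λ b → ∑ F (g a b))))

    ∑³-∑-comm : ∀ {r} (f : Fin n₁ → Fin n₂ → Fin n₃ → Fin r → Carrier) →
                ∑³ (λ a b c → ∑ F (f a b c)) ≈ ∑ F (λ s → ∑³ (λ a b c → f a b c s))
    ∑³-∑-comm f =
      trans (∑-cong (λ a → trans (∑-cong (λ b → ∑-comm (f a b)))
                                 (∑-comm (λ b s → ∑ F (λ c → f a b c s)))))
            (∑-comm (λ a s → ∑ F (λ b → ∑ F (λ c → f a b c s))))

    ∑³-rotate : (f : Fin n₁ → Fin n₂ → Fin n₃ → Carrier) →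
                ∑ F (λ c → ∑ F (λ a → ∑ F (λ b → f a b c))) ≈ ∑³ f
    ∑³-rotate f = trans (∑-comm (λ c a → ∑ F (λ b → f a b c)))
                        (∑-cong (λ a → ∑-comm (λ c b → f a b c)))

    ∑*∑∑≈∑³ : (g : Fin n₁ → Carrier) (h : Fin n₂ → Fin n₃ → Carrier) →
              ∑ F g * ∑ F (λ b → ∑ F (h b)) ≈ ∑³ (λ a b c → g a * h b c)
    ∑*∑∑≈∑³ g h = trans (*-distribʳ-∑ (∑ F (λ b → ∑ F (h b))) g)
      (∑-cong (λ a → trans (*-distribˡ-∑ (g a) (λ b → ∑ F (h b)))
                           (∑-cong (λ b → *-distribˡ-∑ (g a) (h b)))))

  Matrix : ℕ → ℕ → Set c
  Matrix m n = Fin m → Fin n → Carrier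

  restrict₂ : ∀ {m₁ m₂ n₁ n₂} → Matrix m₁ n₁ → Matrix m₂ n₂ →
              (Fin n₁ → Fin n₂ → Carrier) → Fin m₁ → Fin m₂ → Carrier
  restrict₂ X Y β i j = ∑ F (λ a → ∑ F (λ b → (X i a * Y j b) * β a b))

  -- T(X e_i, Y e_j, Z e_k), where X e_i = ∑_a X i a e_a etc.
  restrict : ∀ {m₁ m₂ m₃ n₁ n₂ n₃} → Matrix m₁ n₁ → Matrix m₂ n₂ → Matrix m₃ n₃ →
             Trilinear F n₁ n₂ n₃ → Trilinear F m₁ m₂ m₃
  restrict X Y Z T i j k = Sum³.∑³ (λ a b c → ((X i a * Y j b) * Z k c) * T a b c)

  module _ {m₁ m₂ m₃ n₁ n₂ n₃ : ℕ}
           (X : Matrix m₁ n₁) (Y : Matrix m₂ n₂) (Z : Matrix m₃ n₃) where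
    open Sum³ {n₁} {n₂} {n₃}

    restrict-cong : ∀ {T U : Trilinear F n₁ n₂ n₃} → (∀ a b c → T a b c ≈ U a b c) →
                    ∀ i j k → restrict X Y Z T i j k ≈ restrict X Y Z U i j k
    restrict-cong T≈U i j k = ∑³-cong (λ a b c → *-congˡ (T≈U a b c))

    restrict-+ : ∀ (T U : Trilinear F n₁ n₂ n₃) i j k →
                 restrict X Y Z (λ a b c → T a b c + U a b c) i j k ≈
                 restrict X Y Z T i j k + restrict X Y Z U i j k
    restrict-+ T U i j k = trans (∑³-cong (λ a b c → distribˡ _ _ _)) (∑³-distrib-+ _ _)

    restrict-swap₁₂ : ∀ (T : Trilinear F n₁ n₂ n₃) i j k →
                      restrict X Y Z T i j k ≈ restrict Y X Z (λ b a c → T a b c) j i k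
    restrict-swap₁₂ T i j k = trans (∑-comm {n₁} {n₂} _)
      (Sum³.∑³-cong {n₂} {n₁} {n₃} (λ b a c → *-congʳ (*-congʳ (*-comm (X i a) (Y j b)))))

    restrict-rotate : ∀ (T : Trilinear F n₁ n₂ n₃) i j k →
                      restrict X Y Z T i j k ≈ restrict Z X Y (λ c a b → T a b c) k i j
    restrict-rotate T i j k = trans (sym (∑³-rotate _))
      (Sum³.∑³-cong {n₃} {n₁} {n₂} (λ c a b → *-congʳ (solve 3 (λ x y z → (x ⊕ y) ⊕ z ⊜ (z ⊕ x) ⊕ y) refl
                                           (X i a) (Y j b) (Z k c))))

    restrict-slice : ∀ (α : Fin n₁ → Carrier) (β : Fin n₂ → Fin n₃ → Carrier) i j k →
                     restrict X Y Z (λ a b c → α a * β b c) i j k ≈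
                     apply F X α i * restrict₂ Y Z β j k
    restrict-slice α β i j k = trans
      (∑³-cong (λ a b c → solve 5 (λ x y z a′ b′ → ((x ⊕ y) ⊕ z) ⊕ (a′ ⊕ b′)
                                                  ⊜ (x ⊕ a′) ⊕ ((y ⊕ z) ⊕ b′))
                                  refl (X i a) (Y j b) (Z k c) (α a) (β b c)))
      (sym (∑*∑∑≈∑³ _ _))

    restrict-∑-slices : ∀ {r} (α : Fin r → Fin n₁ → Carrier)
                        (β : Fin r → Fin n₂ → Fin n₃ → Carrier) i j k →
                        restrict X Y Z (λ a b c → ∑ F (λ s → α s a * β s b c)) i j k ≈
                        ∑ F (λ s → apply F X (α s) i * restrict₂ Y Z (β s) j k)
    restrict-∑-slices {r} α β i j k = begin
      restrict X Y Z (λ a b c → ∑ F (λ s → α s a * β s b c)) i j k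
        ≈⟨ ∑³-cong (λ a b c → *-distribˡ-∑ _ (λ s → α s a * β s b c)) ⟩
      ∑³ (λ a b c → ∑ F (λ s → ((X i a * Y j b) * Z k c) * (α s a * β s b c)))
        ≈⟨ ∑³-∑-comm {r} _ ⟩
      ∑ F (λ s → restrict X Y Z (λ a b c → α s a * β s b c) i j k)
        ≈⟨ ∑-cong (λ s → restrict-slice (α s) (β s) i j k) ⟩
      ∑ F (λ s → apply F X (α s) i * restrict₂ Y Z (β s) j k) ∎

  SliceRank≤-restrict : ∀ {m₁ m₂ m₃ n₁ n₂ n₃ r}
                        (X : Matrix m₁ n₁) (Y : Matrix m₂ n₂) (Z : Matrix m₃ n₃)
                        (T : Trilinear F n₁ n₂ n₃) →
                        SliceRank≤ F T r → SliceRank≤ F (restrict X Y Z T) r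
  SliceRank≤-restrict {n₁ = n₁} {n₂} {n₃} X Y Z T (r₁ , r₂ , r₃ , r≡ , α₁ , β₁ , α₂ , β₂ , α₃ , β₃ , T≈) =
    r₁ , r₂ , r₃ , r≡ ,
    (λ s → apply F X (α₁ s)) , (λ s → restrict₂ Y Z (β₁ s)) ,
    (λ s → apply F Y (α₂ s)) , (λ s → restrict₂ X Z (β₂ s)) ,
    (λ s → apply F Z (α₃ s)) , (λ s → restrict₂ X Y (β₃ s)) ,
    λ i j k → begin
      restrict X Y Z T i j k
        ≈⟨ restrict-cong X Y Z T≈ i j k ⟩
      restrict X Y Z (λ a b c → (U₁ a b c + U₂ a b c) + U₃ a b c) i j k
        ≈⟨ restrict-+ X Y Z _ U₃ i j k ⟩
      restrict X Y Z (λ a b c → U₁ a b c + U₂ a b c) i j k + restrict X Y Z U₃ i j k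
        ≈⟨ +-congʳ (restrict-+ X Y Z U₁ U₂ i j k) ⟩
      (restrict X Y Z U₁ i j k + restrict X Y Z U₂ i j k) + restrict X Y Z U₃ i j k
        ≈⟨ +-cong (+-cong (restrict-∑-slices X Y Z α₁ β₁ i j k)
                          (trans (restrict-swap₁₂ X Y Z U₂ i j k)
                                 (restrict-∑-slices Y X Z α₂ β₂ j i k)))
                  (trans (restrict-rotate X Y Z U₃ i j k)
                         (restrict-∑-slices Z X Y α₃ β₃ k i j)) ⟩
      _ ∎
    where
    U₁ U₂ U₃ : Trilinear F n₁ n₂ n₃
    U₁ a b c = ∑ F (λ s → α₁ s a * β₁ s b c)
    U₂ a b c = ∑ F (λ s → α₂ s b * β₂ s a c)
    U₃ a b c = ∑ F (λ s → α₃ s c * β₃ s a b)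

  SliceRank≤-resp : ∀ {n₁ n₂ n₃ r} {T U : Trilinear F n₁ n₂ n₃} →
                    (∀ i j k → T i j k ≈ U i j k) → SliceRank≤ F U r → SliceRank≤ F T r
  SliceRank≤-resp T≈U (r₁ , r₂ , r₃ , r≡ , α₁ , β₁ , α₂ , β₂ , α₃ , β₃ , U≈) =
    r₁ , r₂ , r₃ , r≡ , α₁ , β₁ , α₂ , β₂ , α₃ , β₃ , λ i j k → trans (T≈U i j k) (U≈ i j k)

  module _ {n : ℕ} (A : FDAlgebra F n) where
    open FDAlgebra A
    open Sum³ {n} {n} {n}

    ·-cong : ∀ {x x′ y y′} → _≋_ F x x′ → _≋_ F y y′ → _≋_ F (x · y) (x′ · y′)
    ·-cong x≋x′ y≋y′ k = ∑-cong (λ a → ∑-cong (λ b → *-congʳ (*-cong (x≋x′ a) (y≋y′ b))))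

    basis-·-basis : ∀ i j k → (basis i · basis j) k ≈ mult i j k
    basis-·-basis i j k = begin
      ∑ F (λ a → ∑ F (λ b → (basis i a * basis j b) * mult a b k))
        ≈⟨ ∑-cong (λ a → ∑-cong (λ b → *-assoc (basis i a) (basis j b) (mult a b k))) ⟩
      ∑ F (λ a → ∑ F (λ b → basis i a * (basis j b * mult a b k)))
        ≈⟨ ∑-cong (λ a → *-distribˡ-∑ _ (λ b → basis j b * mult a b k)) ⟨
      ∑ F (λ a → basis i a * ∑ F (λ b → basis j b * mult a b k))
        ≈⟨ ∑-cong (λ a → *-congˡ (∑-basis j (λ b → mult a b k))) ⟩
      ∑ F (λ a → basis i a * mult a j k)
        ≈⟨ ∑-basis i (λ a → mult a j k) ⟩
      mult i j k ∎

    apply-·≈restrict : ∀ {m p} (X : Matrix m n) (P : Matrix p n) i j k →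
                       apply F P (X i · X j) k ≈ restrict X X P mult i j k
    apply-·≈restrict X P i j k = begin
      ∑ F (λ c → P k c * ∑ F (λ a → ∑ F (λ b → (X i a * X j b) * mult a b c)))
        ≈⟨ ∑-cong (λ c → trans (*-distribˡ-∑ _ (λ a → ∑ F (λ b → (X i a * X j b) * mult a b c)))
                               (∑-cong (λ a → *-distribˡ-∑ _ (λ b → (X i a * X j b) * mult a b c)))) ⟩
      ∑ F (λ c → ∑ F (λ a → ∑ F (λ b → P k c * ((X i a * X j b) * mult a b c))))
        ≈⟨ ∑³-rotate _ ⟩
      ∑³ (λ a b c → P k c * ((X i a * X j b) * mult a b c))
        ≈⟨ ∑³-cong (λ a b c → trans (sym (*-assoc _ _ _)) (*-congʳ (*-comm _ _))) ⟩
      restrict X X P mult i j k ∎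

  mulTensor-SR≤-surjective-hom :
    ∀ {n m} (A : FDAlgebra F n) (B : FDAlgebra F m) (π : Matrix m n) →
    (∀ y → ∃ λ x → _≋_ F (apply F π x) y) →
    (∀ x y → _≋_ F (apply F π (FDAlgebra._·_ A x y))
                   (FDAlgebra._·_ B (apply F π x) (apply F π y))) →
    _SR≤_ F (mulTensor F B) (mulTensor F A)
  mulTensor-SR≤-surjective-hom A B π surjective multiplicative r SR[A]≤r =
    SliceRank≤-resp multB≈restrict (SliceRank≤-restrict lift lift π (FDAlgebra.mult A) SR[A]≤r)
    where
    module A = FDAlgebra A
    module B = FDAlgebra B

    lift : Matrix _ _
    lift i = proj₁ (surjective (basis i))

    multB≈restrict : ∀ i j k → B.mult i j k ≈ restrict lift lift π A.mult i j k
    multB≈restrict i j k = begin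
      B.mult i j k                                       ≈⟨ basis-·-basis B i j k ⟨
      (basis i B.· basis j) k                            ≈⟨ ·-cong B (proj₂ (surjective (basis i)))
                                                                     (proj₂ (surjective (basis j))) k ⟨
      (apply F π (lift i) B.· apply F π (lift j)) k      ≈⟨ multiplicative (lift i) (lift j) k ⟨
      apply F π (lift i A.· lift j) k                    ≈⟨ apply-·≈restrict A lift π i j k ⟩
      restrict lift lift π A.mult i j k                  ∎

lemma2p2 : ∀ {c ℓ p : Level} (F : Field c ℓ) {n m : ℕ}
           (A : FDAlgebra F n) (I : Ideal F A p)
           (B : FDAlgebra F m) (π : Fin m → Fin n → Field.Carrier F) →
           IsQuotientBy F A I B π →
           _SR≤_ F (mulTensor F B) (mulTensor F A)
lemma2p2 F A I B π quotient =
  mulTensor-SR≤-surjective-hom F A B π surjective multiplicative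
  where open IsQuotientBy quotient
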